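{- Let $n\geq 5$ be an integer and let $G$ be an edge-colored complete $3$-uniform hypergraph $K^{(3)}_n$ that contains no rainbow copy of the tight path $\mathcal{T}$, and suppose $|C(G)|\geq 3$. Write $k=|C(G)|$. Then, after renumbering the colors as $1,2,\ldots,k$ if necessary, the vertex set $V(G)$ can be partitioned into $k-1$ parts $V_2, V_3, \ldots, V_k$ such that $\{i\}\subseteq C(V_i)\subseteq \{1,i\}$ for every $i\in\{2,3,\ldots,k\}$, and every edge not contained in a single part $V_i$ has color $1$.
   Context: An edge-coloring of a hypergraph $G$ is any map $c:E(G)\to \mathbb{N}$ (not necessarily proper). $C(G)=\{c(e): e\in E(G)\}$ is the set of colors used. For $U\subseteq V(G)$, $C(U)=\{c(e): e\in E(G),\ e\subseteq U\}$. A copy of a hypergraph $H$ in $G$ is a subhypergraph isomorphic to $H$; it is rainbow if all its edges have distinct colors. $K^{(3)}_n$ is the 3-uniform hypergraph on $n$ vertices whose edges are all 3-element subsets. The tight path $\mathcal{T}$ is the 3-graph with vertices $v_1,\ldots,v_5$ and edges $\{v_1v_2v_3, v_2v_3v_4, v_3v_4v_5\}$. -}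

module Defs where

open import Data.Nat using (ℕ; suc; _≤_)
open import Data.Fin using (Fin; zero; suc)
open import Data.Product using (Σ; Σ-syntax; _×_; ∃-syntax)
open import Data.Sum using (_⊎_)
open import Relation.Nullary using (¬_)
open import Relation.Binary.PropositionalEquality using (_≡_; _≢_)
open import Function.Definitions using (Injective)

-- Edges are 3-element subsets {a,b,d}; we represent the colouring as a
-- function on ordered triples that is invariant under permuting the triple.
-- Only values on triples of pairwise distinct vertices are meaningful.
record Coloring (n : ℕ) : Set where
  field
    col   : Fin n → Fin n → Fin n → ℕ
    sym₁₂ : ∀ a b d → col a b d ≡ col b a d
    sym₂₃ : ∀ a b d → col a b d ≡ col a d b
open Coloring public

Distinct3 : {n : ℕ} → Fin n → Fin n → Fin n → Set
Distinct3 a b d = a ≢ b × a ≢ d × b ≢ d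

Distinct5 : {n : ℕ} → Fin n → Fin n → Fin n → Fin n → Fin n → Set
Distinct5 v₁ v₂ v₃ v₄ v₅ =
  v₁ ≢ v₂ × v₁ ≢ v₃ × v₁ ≢ v₄ × v₁ ≢ v₅ ×
  v₂ ≢ v₃ × v₂ ≢ v₄ × v₂ ≢ v₅ ×
  v₃ ≢ v₄ × v₃ ≢ v₅ ×
  v₄ ≢ v₅

UsedColor : {n : ℕ} → Coloring n → ℕ → Set
UsedColor {n} c x = Σ[ a ∈ Fin n ] Σ[ b ∈ Fin n ] Σ[ d ∈ Fin n ]
  (Distinct3 a b d × col c a b d ≡ x)

-- g : Fin k → ℕ is a bijection from Fin k onto C(G); in particular |C(G)| = k.
-- Index j : Fin k stands for colour number (toℕ j + 1).
Enumerates : {n : ℕ} → Coloring n → (k : ℕ) → (Fin k → ℕ) → Set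
Enumerates {n} c k g =
  Injective _≡_ _≡_ g ×
  (∀ j → UsedColor c (g j)) ×
  (∀ x → UsedColor c x → Σ[ j ∈ Fin k ] g j ≡ x)

RainbowTightPath : {n : ℕ} → Coloring n →
  Fin n → Fin n → Fin n → Fin n → Fin n → Set
RainbowTightPath c v₁ v₂ v₃ v₄ v₅ =
  col c v₁ v₂ v₃ ≢ col c v₂ v₃ v₄ ×
  col c v₁ v₂ v₃ ≢ col c v₃ v₄ v₅ ×
  col c v₂ v₃ v₄ ≢ col c v₃ v₄ v₅

NoRainbowTightPath : {n : ℕ} → Coloring n → Set
NoRainbowTightPath {n} c = ∀ (v₁ v₂ v₃ v₄ v₅ : Fin n) →
  Distinct5 v₁ v₂ v₃ v₄ v₅ → ¬ RainbowTightPath c v₁ v₂ v₃ v₄ v₅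

-- With k+1 colours numbered by g : Fin (suc k) → ℕ (index zero = colour 1,
-- index suc i = colour i+2), and parts V_{i+2} = { v | part v ≡ i } for i : Fin k
-- (so k parts V_2..V_{k+1}):
--  * {colour i+2} ⊆ C(V_{i+2}) ⊆ {colour 1, colour i+2}
--  * every edge not inside a single part has colour 1.
PartitionStructure : {n k : ℕ} → Coloring n → (Fin (suc k) → ℕ) → (Fin n → Fin k) → Set
PartitionStructure {n} {k} c g part =
  (∀ (i : Fin k) → Σ[ a ∈ Fin n ] Σ[ b ∈ Fin n ] Σ[ d ∈ Fin n ]
      (Distinct3 a b d × part a ≡ i × part b ≡ i × part d ≡ i ×
       col c a b d ≡ g (suc i))) ×
  (∀ (i : Fin k) (a b d : Fin n) → Distinct3 a b d →
      part a ≡ i → part b ≡ i → part d ≡ i →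
      col c a b d ≡ g zero ⊎ col c a b d ≡ g (suc i)) ×
  (∀ (a b d : Fin n) → Distinct3 a b d →
      ¬ (part a ≡ part b × part b ≡ part d) →
      col c a b d ≡ g zero)

{-# OPTIONS --safe #-}
-- Putting a vertex a in the middle of a tight path shows that the link graph of a (the pairs s t,
-- coloured by χ a s t) has no rainbow path with three edges. Tight paths whose last edge avoids a
-- moreover exclude rainbow triangles in the link once a fifth vertex exists, and together this
-- forces every vertex to lie on edges of at most two colours. Call two colours adjacent when some
-- vertex sees both. Any two vertices share the colour of an edge through both, so two adjacent
-- pairs of colours always meet, and no three colours are pairwise adjacent; with at least three
-- colours the adjacency graph is therefore a star. Its centre becomes colour 1, and every vertex
-- joins the part of the unique other colour it sees.
module Submission where

open import Defs
open import Data.Nat using (ℕ; suc; _+_; _≤_; _<_; s≤s) renaming (_≟_ to _≟ℕ_)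
open import Data.Nat.Properties using (<⇒≱)
open import Data.Fin using (Fin; zero; suc)
open import Data.Fin.Patterns using (0F; 1F; 2F; 3F)
open import Data.Fin.Properties using (any?; all?; ¬∀⟶∃¬; injective⇒≤; suc-injective)
  renaming (_≟_ to _≟ᶠ_)
open import Data.Fin.Permutation using (Permutation; _⟨$⟩ʳ_; _⟨$⟩ˡ_; inverseˡ; inverseʳ; transpose)
open import Data.Product using (Σ-syntax; ∃-syntax; _×_; _,_; proj₁; proj₂; map₂)
open import Data.Sum using (_⊎_; inj₁; inj₂)
open import Data.Empty using (⊥; ⊥-elim)
open import Function using (_∘_)
open import Function.Definitions using (Injective)
open import Relation.Nullary using (¬_; Dec; yes; no; contradiction)
open import Relation.Nullary.Decidable using (¬?; _×-dec_; _⊎-dec_; decidable-stable)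
open import Relation.Binary.PropositionalEquality using (_≡_; _≢_; refl; sym; trans; cong; subst; ≢-sym)

missed-value : ∀ {m n} → m < n → (f : Fin m → Fin n) → ∃[ y ] (∀ i → f i ≢ y)
missed-value {m} m<n f with any? (λ y → all? (λ i → ¬? (f i ≟ᶠ y)))
... | yes missed = missed
... | no ¬missed = contradiction (injective⇒≤ preimage-injective) (<⇒≱ m<n)
  where
    preimage : ∀ y → ∃[ i ] f i ≡ y
    preimage y = map₂ (λ {i} → decidable-stable (f i ≟ᶠ y))
                      (¬∀⟶∃¬ m (λ i → f i ≢ y) (λ i → ¬? (f i ≟ᶠ y)) (¬missed ∘ (y ,_)))
    preimage-injective : Injective _≡_ _≡_ (proj₁ ∘ preimage)
    preimage-injective {y} {y′} eq =
      trans (sym (proj₂ (preimage y))) (trans (cong f eq) (proj₂ (preimage y′)))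

fresh-vertex : ∀ {n} → 5 ≤ n → (p q r s : Fin n) → ∃[ w ] (p ≢ w × q ≢ w × r ≢ w × s ≢ w)
fresh-vertex 5≤n p q r s with missed-value 5≤n (λ { 0F → p ; 1F → q ; 2F → r ; 3F → s })
... | w , avoids = w , avoids 0F , avoids 1F , avoids 2F , avoids 3F

Rainbow : ℕ → ℕ → ℕ → Set
Rainbow x y z = x ≢ y × x ≢ z × y ≢ z

rainbow-cong : ∀ {x x′ y y′ z} → x ≡ x′ → y ≡ y′ → Rainbow x y z → Rainbow x′ y′ z
rainbow-cong refl refl rainbow = rainbow

first-three-distinct : ∀ {k} {f : Fin (3 + k) → ℕ} → Injective _≡_ _≡_ f → Rainbow (f 0F) (f 1F) (f 2F)
first-three-distinct f-injective =
  (λ e → contradiction (f-injective e) (λ ())) ,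
  (λ e → contradiction (f-injective e) (λ ())) ,
  (λ e → contradiction (f-injective e) (λ ()))

infix 4 _∈⟨_,_⟩
_∈⟨_,_⟩ : ℕ → ℕ → ℕ → Set
z ∈⟨ x , y ⟩ = z ≡ x ⊎ z ≡ y

∈⟨⟩-stable : ∀ {x y z} → ¬ ¬ z ∈⟨ x , y ⟩ → z ∈⟨ x , y ⟩
∈⟨⟩-stable {x} {y} {z} = decidable-stable ((z ≟ℕ x) ⊎-dec (z ≟ℕ y))

∈⟨⟩-cong : ∀ {x x′ y y′ z} → x ≡ x′ → y ≡ y′ → z ∈⟨ x , y ⟩ → z ∈⟨ x′ , y′ ⟩
∈⟨⟩-cong refl refl z∈ = z∈

∈⟨⟩-meet : ∀ {x y y′ z} → y ≢ y′ → z ∈⟨ x , y ⟩ → z ∈⟨ x , y′ ⟩ → z ≡ x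
∈⟨⟩-meet _     (inj₁ z≡x) _          = z≡x
∈⟨⟩-meet _     (inj₂ _)   (inj₁ z≡x) = z≡x
∈⟨⟩-meet y≢y′ (inj₂ z≡y) (inj₂ z≡y′) = contradiction (trans (sym z≡y) z≡y′) y≢y′

∈⟨⟩-excluded : ∀ {x y z} → z ≢ x → z ≢ y → ¬ z ∈⟨ x , y ⟩
∈⟨⟩-excluded z≢x _   (inj₁ z≡x) = z≢x z≡x
∈⟨⟩-excluded _   z≢y (inj₂ z≡y) = z≢y z≡y

∈⟨⟩-trans : ∀ {x y z u v} → z ∈⟨ u , v ⟩ → u ∈⟨ x , y ⟩ → v ∈⟨ x , y ⟩ → z ∈⟨ x , y ⟩
∈⟨⟩-trans (inj₁ refl) u∈ _  = u∈
∈⟨⟩-trans (inj₂ refl) _  v∈ = v∈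

third-in : ∀ {x y z} → ¬ Rainbow x y z → x ≢ y → z ∈⟨ x , y ⟩
third-in ¬rainbow x≢y = ∈⟨⟩-stable λ z∉ → ¬rainbow (x≢y , z∉ ∘ inj₁ ∘ sym , z∉ ∘ inj₂ ∘ sym)

middle-in : ∀ {x y z} → ¬ Rainbow x y z → x ≢ z → y ∈⟨ x , z ⟩
middle-in ¬rainbow x≢z = ∈⟨⟩-stable λ y∉ → ¬rainbow (y∉ ∘ inj₁ ∘ sym , x≢z , y∉ ∘ inj₂)

no-common-member : ∀ {α β δ ζ} → Rainbow α β δ → ζ ∈⟨ α , β ⟩ → ζ ∈⟨ β , δ ⟩ → ζ ∈⟨ α , δ ⟩ → ⊥
no-common-member (α≢β , _ , _) (inj₁ refl) (inj₁ refl) _           = α≢β refl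
no-common-member (_ , α≢δ , _) (inj₁ refl) (inj₂ refl) _           = α≢δ refl
no-common-member (α≢β , _ , _) (inj₂ refl) _           (inj₁ refl) = α≢β refl
no-common-member (_ , _ , β≢δ) (inj₂ refl) _           (inj₂ refl) = β≢δ refl

Distinct4 : ∀ {n} → Fin n → Fin n → Fin n → Fin n → Set
Distinct4 a p q r = a ≢ p × a ≢ q × a ≢ r × p ≢ q × p ≢ r × q ≢ r

Distinct3-swap : ∀ {n} {a p q : Fin n} → Distinct3 a p q → Distinct3 a q p
Distinct3-swap (a≢p , a≢q , p≢q) = a≢q , a≢p , ≢-sym p≢q

module _ {n : ℕ} (c : Coloring n) where

  Sees : Fin n → ℕ → Set
  Sees v α = Σ[ s ∈ Fin n ] Σ[ t ∈ Fin n ] (Distinct3 v s t × col c v s t ≡ α)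

  Adjacent : ℕ → ℕ → Set
  Adjacent α β = Σ[ v ∈ Fin n ] (Sees v α × Sees v β)

  IsCentre : ℕ → Set
  IsCentre γ = ∀ {x y} → x ≢ y → Adjacent x y → x ≡ γ ⊎ y ≡ γ

  sees₁ : ∀ {a b d} → Distinct3 a b d → Sees a (col c a b d)
  sees₁ {a} {b} {d} abd = b , d , abd , refl

  sees₂ : ∀ {a b d} → Distinct3 a b d → Sees b (col c a b d)
  sees₂ {a} {b} {d} (a≢b , a≢d , b≢d) = a , d , (≢-sym a≢b , b≢d , a≢d) , sym₁₂ c b a d

  sees₃ : ∀ {a b d} → Distinct3 a b d → Sees d (col c a b d)
  sees₃ {a} {b} {d} (a≢b , a≢d , b≢d) =
    a , b , (≢-sym a≢d , ≢-sym b≢d , a≢b) , trans (sym₁₂ c d a b) (sym₂₃ c a d b)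

  sees⇒used : ∀ {v α} → Sees v α → UsedColor c α
  sees⇒used (s , t , vst , e) = _ , s , t , vst , e

  sees? : ∀ v α → Dec (Sees v α)
  sees? v α = any? λ s → any? λ t →
    (¬? (v ≟ᶠ s) ×-dec ¬? (v ≟ᶠ t) ×-dec ¬? (s ≟ᶠ t)) ×-dec (col c v s t ≟ℕ α)

  edge-meeting : ∀ {p q r} → Distinct3 p q r → ∀ s →
                 ∃[ x ] ∃[ y ] (Distinct3 s x y × Sees x (col c p q r))
  edge-meeting {p} {q} {r} pqr@(p≢q , p≢r , q≢r) s with s ≟ᶠ p | s ≟ᶠ q
  ... | yes refl | _        = q , r , pqr , sees₂ pqr
  ... | no _     | yes refl = p , r , (≢-sym p≢q , q≢r , p≢r) , sees₁ pqr
  ... | no s≢p   | no s≢q   = p , q , (s≢p , s≢q , p≢q) , sees₁ pqr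

  adjacent-sym : ∀ {α β} → Adjacent α β → Adjacent β α
  adjacent-sym (v , sα , sβ) = v , sβ , sα

  enumerates-permute : ∀ {k} {f : Fin k → ℕ} (π : Permutation k k) →
                       Enumerates c k f → Enumerates c k (f ∘ (π ⟨$⟩ʳ_))
  enumerates-permute {f = f} π (f-injective , f-used , f-onto) =
    (λ eq → trans (sym (inverseˡ π)) (trans (cong (π ⟨$⟩ˡ_) (f-injective eq)) (inverseˡ π))) ,
    (λ j → f-used (π ⟨$⟩ʳ j)) ,
    (λ x usedx → let (j , fj≡x) = f-onto x usedx in π ⟨$⟩ˡ j , trans (cong f (inverseʳ π)) fj≡x)

  enumerates-from : ∀ {k γ} {f : Fin (suc k) → ℕ} → Enumerates c (suc k) f → UsedColor c γ →
                    ∃[ g ] (Enumerates c (suc k) g × g zero ≡ γ)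
  enumerates-from {f = f} f-enum@(_ , _ , f-onto) usedγ =
    let (j , fj≡γ) = f-onto _ usedγ
    in f ∘ (transpose zero j ⟨$⟩ʳ_) , enumerates-permute (transpose zero j) f-enum , fj≡γ

module TightPathFree {n : ℕ} (c : Coloring n) (noRainbow : NoRainbowTightPath c) (5≤n : 5 ≤ n) where

  χ : Fin n → Fin n → Fin n → ℕ
  χ = col c

  χ-rotate : ∀ a b d → χ a b d ≡ χ b d a
  χ-rotate a b d = trans (sym₁₂ c a b d) (sym₂₃ c b a d)

  χ-reverse : ∀ a b d → χ a b d ≡ χ d b a
  χ-reverse a b d = trans (sym₂₃ c a b d) (χ-rotate a d b)

  variable
    a p q r s t u v w z : Fin n
    α β γ δ ε ζ θ : ℕ

  link-path : Distinct5 a s t u w → ¬ Rainbow (χ a t s) (χ a t u) (χ a u w)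
  link-path {a} {s} {t} {u} {w} (a≢s , a≢t , a≢u , a≢w , s≢t , s≢u , s≢w , t≢u , t≢w , u≢w) =
    noRainbow s t a u w (s≢t , ≢-sym a≢s , s≢u , s≢w , ≢-sym a≢t , t≢u , t≢w , a≢u , a≢w , u≢w)
    ∘ rainbow-cong (χ-reverse a t s) (sym₁₂ c a t u)

  outer-edge : Distinct5 a u v z w → χ a u w ≢ χ a u v → χ u v z ∈⟨ χ a u w , χ a u v ⟩
  outer-edge {a} {u} {v} {z} {w} (a≢u , a≢v , a≢z , a≢w , u≢v , u≢z , u≢w , v≢z , v≢w , z≢w) =
    third-in (noRainbow w a u v z
                (≢-sym a≢w , ≢-sym u≢w , ≢-sym v≢w , ≢-sym z≢w , a≢u , a≢v , a≢z , u≢v , u≢z , v≢z)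
              ∘ rainbow-cong (sym (χ-rotate w a u)) refl)

  far-edge : Distinct5 a p q r w → χ a p q ≢ χ a p r → χ a r w ∈⟨ χ a p q , χ a p r ⟩
  far-edge (a≢p , a≢q , a≢r , a≢w , p≢q , p≢r , p≢w , q≢r , q≢w , r≢w) =
    third-in (link-path (a≢q , a≢p , a≢r , a≢w , ≢-sym p≢q , q≢r , q≢w , p≢r , p≢w , r≢w))

  triangle-opposite : Distinct5 a p q r w → Rainbow (χ a p q) (χ a q r) (χ a r p) → χ a q w ≡ χ a r p
  triangle-opposite {a} {p} {q} {r} {w} (a≢p , a≢q , a≢r , a≢w , p≢q , p≢r , p≢w , q≢r , q≢w , r≢w)
                    (pq≢qr , pq≢rp , qr≢rp) =
    ∈⟨⟩-meet rq≢pq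
      (far-edge (a≢r , a≢p , a≢q , a≢w , ≢-sym p≢r , ≢-sym q≢r , r≢w , p≢q , p≢w , q≢w) rp≢rq)
      (∈⟨⟩-cong (sym₂₃ c a p r) refl
        (far-edge (a≢p , a≢r , a≢q , a≢w , p≢r , p≢q , p≢w , ≢-sym q≢r , r≢w , q≢w) pr≢pq))
    where
      rp≢rq : χ a r p ≢ χ a r q
      rp≢rq e = qr≢rp (trans (sym₂₃ c a q r) (sym e))
      pr≢pq : χ a p r ≢ χ a p q
      pr≢pq e = pq≢rp (trans (sym e) (sym₂₃ c a p r))
      rq≢pq : χ a r q ≢ χ a p q
      rq≢pq e = pq≢qr (trans (sym e) (sym₂₃ c a r q))

  -- With a fifth vertex w, the link on p q r w is the proper 3-edge-colouring of K₄, and then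
  -- outer-edge leaves no colour for the edge p q r.
  no-rainbow-triangle⁺ : Distinct5 a p q r w → ¬ Rainbow (χ a p q) (χ a q r) (χ a r p)
  no-rainbow-triangle⁺ {a} {p} {q} {r} {w}
                       apqrw@(a≢p , a≢q , a≢r , a≢w , p≢q , p≢r , p≢w , q≢r , q≢w , r≢w)
                       rainbow@(pq≢qr , pq≢rp , qr≢rp) =
    ∈⟨⟩-excluded (λ e → qr≢rp (trans (sym qpr≡qr) (trans e qw≡rp)))
                 (λ e → pq≢qr (trans (sym₂₃ c a p q) (trans (sym e) qpr≡qr)))
                 (outer-edge (a≢q , a≢p , a≢r , a≢w , ≢-sym p≢q , q≢r , q≢w , p≢r , p≢w , r≢w) qw≢qp)
    where
      qw≡rp : χ a q w ≡ χ a r p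
      qw≡rp = triangle-opposite apqrw rainbow
      pw≡qr : χ a p w ≡ χ a q r
      pw≡qr = triangle-opposite (a≢r , a≢p , a≢q , a≢w , ≢-sym p≢r , ≢-sym q≢r , r≢w , p≢q , p≢w , q≢w)
                                (≢-sym pq≢rp , ≢-sym qr≢rp , pq≢qr)
      pq≢pr : χ a p q ≢ χ a p r
      pq≢pr e = pq≢rp (trans e (sym₂₃ c a p r))
      pw≢pq : χ a p w ≢ χ a p q
      pw≢pq e = pq≢qr (trans (sym e) pw≡qr)
      pw≢pr : χ a p w ≢ χ a p r
      pw≢pr e = qr≢rp (trans (sym pw≡qr) (trans e (sym₂₃ c a p r)))
      qw≢qp : χ a q w ≢ χ a q p
      qw≢qp e = pq≢rp (trans (sym₂₃ c a p q) (trans (sym e) qw≡rp))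
      pqr≡pw : χ p q r ≡ χ a p w
      pqr≡pw = ∈⟨⟩-meet pq≢pr (outer-edge apqrw pw≢pq)
                 (subst (_∈⟨ χ a p w , χ a p r ⟩) (sym₂₃ c p r q)
                   (outer-edge (a≢p , a≢r , a≢q , a≢w , p≢r , p≢q , p≢w , ≢-sym q≢r , r≢w , q≢w) pw≢pr))
      qpr≡qr : χ q p r ≡ χ a q r
      qpr≡qr = trans (sym₁₂ c q p r) (trans pqr≡pw pw≡qr)

  no-rainbow-triangle : Distinct4 a p q r → ¬ Rainbow (χ a p q) (χ a q r) (χ a r p)
  no-rainbow-triangle {a} {p} {q} {r} (a≢p , a≢q , a≢r , p≢q , p≢r , q≢r) with fresh-vertex 5≤n a p q r
  ... | w , a≢w , p≢w , q≢w , r≢w =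
        no-rainbow-triangle⁺ (a≢p , a≢q , a≢r , a≢w , p≢q , p≢r , p≢w , q≢r , q≢w , r≢w)

  triangle-closed : Distinct4 a p q r → χ a p q ≢ χ a p r → χ a q r ∈⟨ χ a p q , χ a p r ⟩
  triangle-closed {a} {p} {q} {r} apqr pq≢pr = ∈⟨⟩-stable λ qr∉ →
    no-rainbow-triangle apqr ( (λ e → qr∉ (inj₁ (sym e)))
                             , (λ e → pq≢pr (trans e (sym₂₃ c a r p)))
                             , (λ e → qr∉ (inj₂ (trans e (sym₂₃ c a r p)))) )

  -- If χ a q t is the colour of p r, the triangle at q closes; otherwise the link path q t p r
  -- starts and ends in the two colours of the cherry.
  centre-edge : Distinct4 a p q r → χ a p q ≢ χ a p r → a ≢ t → p ≢ t → χ a p t ∈⟨ χ a p q , χ a p r ⟩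
  centre-edge {a} {p} {q} {r} {t} (a≢p , a≢q , a≢r , p≢q , p≢r , q≢r) pq≢pr a≢t p≢t with q ≟ᶠ t | r ≟ᶠ t
  ... | yes refl | _        = inj₁ refl
  ... | no _     | yes refl = inj₂ refl
  ... | no q≢t   | no r≢t
        with far-edge (a≢p , a≢r , a≢q , a≢t , p≢r , p≢q , p≢t , ≢-sym q≢r , r≢t , q≢t) (≢-sym pq≢pr)
  ...   | inj₁ qt≡pr =
          ∈⟨⟩-cong (sym₂₃ c a q p) qt≡pr
            (triangle-closed (a≢q , a≢p , a≢t , ≢-sym p≢q , q≢t , p≢t)
                             (λ e → pq≢pr (trans (sym₂₃ c a p q) (trans e qt≡pr))))
  ...   | inj₂ qt≡pq =
          subst (_∈⟨ χ a p q , χ a p r ⟩) (sym₂₃ c a t p)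
            (∈⟨⟩-cong (trans (sym₂₃ c a t q) qt≡pq) refl
              (middle-in (link-path (a≢q , a≢t , a≢p , a≢r , q≢t , ≢-sym p≢q , q≢r , ≢-sym p≢t , ≢-sym r≢t , p≢r))
                         (λ e → pq≢pr (trans (sym qt≡pq) (trans (sym₂₃ c a q t) e)))))

  monochrome-cherry : Distinct4 a p s t → Distinct3 a p u → χ a p u ≢ χ a p t → χ a p s ≡ χ a p t →
                      χ a s t ∈⟨ χ a p u , χ a p t ⟩
  monochrome-cherry {a} {p} {s} {t} {u} (a≢p , a≢s , a≢t , p≢s , p≢t , s≢t) (_ , a≢u , p≢u) pu≢pt ps≡pt =
    subst (_∈⟨ χ a p u , χ a p t ⟩) (sym₂₃ c a t s)
      (far-edge (a≢p , a≢u , a≢t , a≢s , p≢u , p≢t , p≢s , u≢t , u≢s , ≢-sym s≢t) pu≢pt)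
    where
      u≢t : u ≢ t
      u≢t u≡t = pu≢pt (cong (χ a p) u≡t)
      u≢s : u ≢ s
      u≢s u≡s = pu≢pt (trans (cong (χ a p) u≡s) ps≡pt)

  off-centre-edge : Distinct4 a p q r → χ a p q ≢ χ a p r → Distinct4 a p s t →
                    χ a p s ∈⟨ χ a p q , χ a p r ⟩ → χ a p t ∈⟨ χ a p q , χ a p r ⟩ →
                    χ a s t ∈⟨ χ a p q , χ a p r ⟩
  off-centre-edge {a} {p} {q} {r} {s} {t} (a≢p , a≢q , a≢r , p≢q , p≢r , _) pq≢pr apst ps∈ pt∈
    with χ a p s ≟ℕ χ a p t
  ... | no ps≢pt = ∈⟨⟩-trans (triangle-closed apst ps≢pt) ps∈ pt∈
  ... | yes ps≡pt with χ a p q ≟ℕ χ a p t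
  ...   | no pq≢pt  = ∈⟨⟩-trans (monochrome-cherry apst (a≢p , a≢q , p≢q) pq≢pt ps≡pt) (inj₁ refl) pt∈
  ...   | yes pq≡pt = ∈⟨⟩-trans (monochrome-cherry apst (a≢p , a≢r , p≢r) pr≢pt ps≡pt) (inj₂ refl) pt∈
    where
      pr≢pt : χ a p r ≢ χ a p t
      pr≢pt e = pq≢pr (trans pq≡pt (sym e))

  cherry-bound : Distinct4 a p q r → χ a p q ≢ χ a p r → Distinct3 a s t → χ a s t ∈⟨ χ a p q , χ a p r ⟩
  cherry-bound {a} {p} {q} {r} {s} {t} apqr@(a≢p , _) pq≢pr (a≢s , a≢t , s≢t) with s ≟ᶠ p | t ≟ᶠ p
  ... | yes refl | _        = centre-edge apqr pq≢pr a≢t s≢t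
  ... | no _     | yes refl =
        subst (_∈⟨ χ a p q , χ a p r ⟩) (sym₂₃ c a t s) (centre-edge apqr pq≢pr a≢s (≢-sym s≢t))
  ... | no s≢p   | no t≢p   =
        off-centre-edge apqr pq≢pr (a≢p , a≢s , a≢t , ≢-sym s≢p , ≢-sym t≢p , s≢t)
          (centre-edge apqr pq≢pr a≢s (≢-sym s≢p)) (centre-edge apqr pq≢pr a≢t (≢-sym t≢p))

  Cherry : Fin n → ℕ → ℕ → Set
  Cherry a α β = Σ[ p ∈ Fin n ] Σ[ q ∈ Fin n ] Σ[ r ∈ Fin n ]
                   (Distinct4 a p q r × χ a p q ≡ α × χ a p r ≡ β)

  cherry : Distinct3 a p q → Distinct3 a p r → χ a p q ≡ α → χ a p r ≡ β → α ≢ β → Cherry a α β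
  cherry {a} {p} {q} {r} (a≢p , a≢q , p≢q) (_ , a≢r , p≢r) pq≡α pr≡β α≢β =
    p , q , r , (a≢p , a≢q , a≢r , p≢q , p≢r , q≢r) , pq≡α , pr≡β
    where
      q≢r : q ≢ r
      q≢r q≡r = α≢β (trans (sym pq≡α) (trans (cong (χ a p) q≡r) pr≡β))

  -- Two edges at a that share no second vertex are joined by the link path t s s′ t′.
  sees-cherry : α ≢ β → Sees c a α → Sees c a β → Cherry a α β
  sees-cherry {a = a} α≢β (s , t , ast@(a≢s , a≢t , s≢t) , refl)
                          (s′ , t′ , as′t′@(a≢s′ , a≢t′ , s′≢t′) , refl)
    with s ≟ᶠ s′ | s ≟ᶠ t′ | t ≟ᶠ s′ | t ≟ᶠ t′
  ... | yes refl | _        | _        | _        = cherry ast as′t′ refl refl α≢β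
  ... | no _     | yes refl | _        | _        =
        cherry ast (Distinct3-swap as′t′) refl (sym₂₃ c a s s′) α≢β
  ... | no _     | no _     | yes refl | _        =
        cherry (Distinct3-swap ast) as′t′ (sym₂₃ c a t s) refl α≢β
  ... | no _     | no _     | no _     | yes refl =
        cherry (Distinct3-swap ast) (Distinct3-swap as′t′) (sym₂₃ c a t s) (sym₂₃ c a t s′) α≢β
  ... | no s≢s′  | no s≢t′  | no t≢s′  | no t≢t′
        with middle-in (link-path (a≢t , a≢s , a≢s′ , a≢t′ , ≢-sym s≢t , t≢s′ , t≢t′ , s≢s′ , s≢t′ , s′≢t′))
                       α≢β
  ...   | inj₁ ss′≡α = cherry (a≢s′ , a≢s , ≢-sym s≢s′) as′t′ (trans (sym₂₃ c a s′ s) ss′≡α) refl α≢β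
  ...   | inj₂ ss′≡β = cherry ast (a≢s , a≢s′ , s≢s′) refl ss′≡β α≢β

  sees-at-most-two : α ≢ β → Sees c a α → Sees c a β → Sees c a ζ → ζ ∈⟨ α , β ⟩
  sees-at-most-two α≢β sα sβ (s , t , ast , refl) with sees-cherry α≢β sα sβ
  ... | p , q , r , apqr , refl , refl = cherry-bound apqr α≢β ast

  common-colour : v ≢ w → ∃[ ζ ] (Sees c v ζ × Sees c w ζ)
  common-colour {v} {w} v≢w with fresh-vertex 5≤n v w v w
  ... | z , v≢z , w≢z , _ = χ v w z , sees₁ c (v≢w , v≢z , w≢z) , sees₂ c (v≢w , v≢z , w≢z)

  adjacent-meet : α ≢ β → Adjacent c α β → δ ≢ ε → Adjacent c δ ε → α ∈⟨ δ , ε ⟩ ⊎ β ∈⟨ δ , ε ⟩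
  adjacent-meet α≢β (v , vα , vβ) δ≢ε (w , wδ , wε) with v ≟ᶠ w
  ... | yes refl = inj₁ (sees-at-most-two δ≢ε wδ wε vα)
  ... | no v≢w with common-colour v≢w
  ...   | ζ , vζ , wζ with sees-at-most-two α≢β vα vβ vζ
  ...     | inj₁ refl = inj₁ (sees-at-most-two δ≢ε wδ wε wζ)
  ...     | inj₂ refl = inj₂ (sees-at-most-two δ≢ε wδ wε wζ)

  no-adjacent-triangle : Rainbow α β δ → Adjacent c α β → Adjacent c β δ → Adjacent c α δ → ⊥
  no-adjacent-triangle rainbow@(α≢β , α≢δ , β≢δ) (u , uα , uβ) (v , vβ , vδ) (w , wα , wδ)
    with u ≟ᶠ v | u ≟ᶠ w | v ≟ᶠ w
  ... | yes refl | _        | _        =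
        no-common-member rainbow (sees-at-most-two α≢β uα uβ vδ) (inj₂ refl) (inj₂ refl)
  ... | no _     | yes refl | _        =
        no-common-member rainbow (sees-at-most-two α≢β uα uβ wδ) (inj₂ refl) (inj₂ refl)
  ... | no _     | no _     | yes refl =
        no-common-member rainbow (inj₁ refl) (sees-at-most-two β≢δ vβ vδ wα) (inj₁ refl)
  ... | no u≢v   | no u≢w   | no v≢w   =
        no-common-member rainbow (sees-at-most-two α≢β uα uβ (sees₁ c uvw))
                                 (sees-at-most-two β≢δ vβ vδ (sees₂ c uvw))
                                 (sees-at-most-two α≢δ wα wδ (sees₃ c uvw))
    where
      uvw : Distinct3 u v w
      uvw = u≢v , u≢w , v≢w

  two-neighbours⇒centre : γ ≢ β → Adjacent c γ β → γ ≢ δ → Adjacent c γ δ → β ≢ δ → IsCentre c γ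
  two-neighbours⇒centre γ≢β γβ γ≢δ γδ β≢δ x≢y xy
    with adjacent-meet x≢y xy γ≢β γβ | adjacent-meet x≢y xy γ≢δ γδ
  ... | inj₁ (inj₁ x≡γ)  | _                = inj₁ x≡γ
  ... | inj₂ (inj₁ y≡γ)  | _                = inj₂ y≡γ
  ... | _                | inj₁ (inj₁ x≡γ)  = inj₁ x≡γ
  ... | _                | inj₂ (inj₁ y≡γ)  = inj₂ y≡γ
  ... | inj₁ (inj₂ refl) | inj₁ (inj₂ refl) = contradiction refl β≢δ
  ... | inj₁ (inj₂ refl) | inj₂ (inj₂ refl) =
        ⊥-elim (no-adjacent-triangle (γ≢β , γ≢δ , β≢δ) γβ xy γδ)
  ... | inj₂ (inj₂ refl) | inj₁ (inj₂ refl) =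
        ⊥-elim (no-adjacent-triangle (γ≢β , γ≢δ , β≢δ) γβ (adjacent-sym c xy) γδ)
  ... | inj₂ (inj₂ refl) | inj₂ (inj₂ refl) = contradiction refl β≢δ

  adjacent-colour : UsedColor c δ → UsedColor c ε → δ ≢ ε → ∃[ ζ ] (δ ≢ ζ × Adjacent c δ ζ)
  adjacent-colour {δ} {ε} (p , q , r , pqr , refl) (s , t , u , stu , refl) δ≢ε with edge-meeting c pqr s
  ... | x , y , sxy , xδ with χ s x y ≟ℕ δ
  ...   | yes sxy≡δ = ε , δ≢ε , s , subst (Sees c s) sxy≡δ (sees₁ c sxy) , sees₁ c stu
  ...   | no sxy≢δ  = χ s x y , ≢-sym sxy≢δ , x , xδ , sees₂ c sxy

  centre-from-edge : α ≢ ζ → Adjacent c α ζ → UsedColor c θ → θ ≢ α → θ ≢ ζ →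
                     ∃[ γ ] (UsedColor c γ × IsCentre c γ)
  centre-from-edge α≢ζ αζ@(_ , seesα , seesζ) usedθ θ≢α θ≢ζ
    with adjacent-colour usedθ (sees⇒used c seesα) θ≢α
  ... | η , θ≢η , θη with adjacent-meet θ≢η θη α≢ζ αζ
  ...   | inj₁ θ∈⟨α,ζ⟩     = ⊥-elim (∈⟨⟩-excluded θ≢α θ≢ζ θ∈⟨α,ζ⟩)
  ...   | inj₂ (inj₁ refl) =
          _ , sees⇒used c seesα ,
          two-neighbours⇒centre α≢ζ αζ (≢-sym θ≢α) (adjacent-sym c θη) (≢-sym θ≢ζ)
  ...   | inj₂ (inj₂ refl) =
          _ , sees⇒used c seesζ ,
          two-neighbours⇒centre (≢-sym α≢ζ) (adjacent-sym c αζ) (≢-sym θ≢ζ) (adjacent-sym c θη) (≢-sym θ≢α)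

  centre-exists : UsedColor c α → UsedColor c β → UsedColor c δ → Rainbow α β δ →
                  ∃[ γ ] (UsedColor c γ × IsCentre c γ)
  centre-exists {β = β} usedα usedβ usedδ (α≢β , α≢δ , β≢δ) with adjacent-colour usedα usedβ α≢β
  ... | ζ , α≢ζ , αζ with β ≟ℕ ζ
  ...   | yes refl = centre-from-edge α≢ζ αζ usedδ (≢-sym α≢δ) (≢-sym β≢δ)
  ...   | no β≢ζ   = centre-from-edge α≢ζ αζ usedβ (≢-sym α≢β) β≢ζ

  centred-enumeration : ∀ {k} {f : Fin (3 + k) → ℕ} → Enumerates c (3 + k) f →
                        ∃[ g ] (Enumerates c (3 + k) g × IsCentre c (g zero))
  centred-enumeration f-enum@(f-injective , f-used , _)
    with centre-exists (f-used 0F) (f-used 1F) (f-used 2F) (first-three-distinct f-injective)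
  ... | γ , usedγ , centreγ with enumerates-from c f-enum usedγ
  ...   | g , g-enum , g₀≡γ = g , g-enum , subst (IsCentre c) (sym g₀≡γ) centreγ

module Partition {n m : ℕ} (c : Coloring n) (g : Fin (suc (suc m)) → ℕ)
                 (g-enum : Enumerates c (suc (suc m)) g) (g-centre : IsCentre c (g zero)) where

  g-injective : Injective _≡_ _≡_ g
  g-injective = proj₁ g-enum

  non-central-unique : ∀ {v i j} → Sees c v (g (suc i)) → Sees c v (g (suc j)) → i ≡ j
  non-central-unique {v} {i} {j} seesᵢ seesⱼ with i ≟ᶠ j
  ... | yes i≡j = i≡j
  ... | no i≢j with g-centre (i≢j ∘ suc-injective ∘ g-injective) (v , seesᵢ , seesⱼ)
  ...   | inj₁ gᵢ≡g₀ = contradiction (g-injective gᵢ≡g₀) λ ()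
  ...   | inj₂ gⱼ≡g₀ = contradiction (g-injective gⱼ≡g₀) λ ()

  -- A vertex that sees only the central colour g zero may go into any part.
  part : Fin n → Fin (suc m)
  part v with any? (λ i → sees? c v (g (suc i)))
  ... | yes (i , _) = i
  ... | no _        = zero

  part-spec : ∀ {v i} → Sees c v (g (suc i)) → part v ≡ i
  part-spec {v} {i} seesᵢ with any? (λ i → sees? c v (g (suc i)))
  ... | yes (j , seesⱼ) = non-central-unique seesⱼ seesᵢ
  ... | no none         = contradiction (i , seesᵢ) none

  edge-part : ∀ {a b d i} → Distinct3 a b d → col c a b d ≡ g (suc i) →
              part a ≡ i × part b ≡ i × part d ≡ i
  edge-part abd e = part-spec (subst (Sees c _) e (sees₁ c abd)) ,
                    part-spec (subst (Sees c _) e (sees₂ c abd)) ,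
                    part-spec (subst (Sees c _) e (sees₃ c abd))

  edge-colour-index : ∀ {a b d} → Distinct3 a b d → ∃[ j ] g j ≡ col c a b d
  edge-colour-index {a} {b} {d} abd = proj₂ (proj₂ g-enum) _ (a , b , d , abd , refl)

  part-contains-own-colour : ∀ i → Σ[ a ∈ Fin n ] Σ[ b ∈ Fin n ] Σ[ d ∈ Fin n ]
    (Distinct3 a b d × part a ≡ i × part b ≡ i × part d ≡ i × col c a b d ≡ g (suc i))
  part-contains-own-colour i with proj₁ (proj₂ g-enum) (suc i)
  ... | a , b , d , abd , e with edge-part abd e
  ...   | pa , pb , pd = a , b , d , abd , pa , pb , pd , e

  inside-part-colours : ∀ i a b d → Distinct3 a b d → part a ≡ i → part b ≡ i → part d ≡ i →
                        col c a b d ≡ g zero ⊎ col c a b d ≡ g (suc i)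
  inside-part-colours i a b d abd refl _ _ with edge-colour-index abd
  ... | zero  , e = inj₁ (sym e)
  ... | suc j , e with edge-part abd (sym e)
  ...   | refl , _ = inj₂ (sym e)

  crossing-edge-central : ∀ a b d → Distinct3 a b d → ¬ (part a ≡ part b × part b ≡ part d) →
                          col c a b d ≡ g zero
  crossing-edge-central a b d abd crossing with edge-colour-index abd
  ... | zero  , e = sym e
  ... | suc j , e with edge-part abd (sym e)
  ...   | pa , pb , pd = contradiction (trans pa (sym pb) , trans pb (sym pd)) crossing

theorem1p3 : (n : ℕ) → 5 ≤ n → (c : Coloring n) → NoRainbowTightPath c →
    (k : ℕ) → 2 ≤ k → (f : Fin (suc k) → ℕ) → Enumerates c (suc k) f →
    Σ[ g ∈ (Fin (suc k) → ℕ) ] Σ[ part ∈ (Fin n → Fin k) ]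
      (Enumerates c (suc k) g × PartitionStructure c g part)
theorem1p3 _ _ _ _ 1 (s≤s ()) _ _
theorem1p3 n 5≤n c noRainbow (suc (suc k)) _ f f-enum =
  let (g , g-enum , g-centre) = TightPathFree.centred-enumeration c noRainbow 5≤n f-enum
      open Partition c g g-enum g-centre
  in g , part , g-enum , part-contains-own-colour , inside-part-colours , crossing-edge-central
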